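{- Let $h\in\{1,\tfrac32,2,\tfrac52,\dots\}$, $z=4h$, and let $Pog_h$, $E$, $V_{12}$ be as in the context. Let $P_2'\subseteq\mathbb{R}^E$ be the polytope of all $x'$ satisfying $\sum_{e\in q}x'_e-\sum_{e\in p\setminus q}x'_e\le |q|-1$ for every $p\in V_{12}$ and every $q\subset p$ with $|p|-|q|$ odd, together with $0\le x'_e\le 1$ for all $e\in E$. Then $P_2'$ is a linear model for the minimum strong $O$-join problem on $Pog_h$: the points of $P_2'$ with all coordinates integer are exactly the characteristic vectors of the strong $O$-joins of $Pog_h$.
   Context: Let $\omega=e^{2\pi i/z}$. The projective orbital graph $Pog_h$ is the graph cellularly embedded in the real projective plane $\mathbb{RP}^2$, viewed as a closed disk $D$ in the complex plane centered at $0$ with antipodal boundary points identified, defined as follows. Let $m=\lfloor h\rfloor$. Vertices: $k\omega^j$ for $k=1,\dots,m$, $j=0,\dots,z-1$, plus the vertex $0$ if $h$ is a half-integer. Edges: orbital edges $[k\omega^j,k\omega^{j+1}]$ (indices mod $z$); radial edges $[k\omega^j,(k+1)\omega^j]$ for $1\le k<m$; if $h$ is a half-integer, the $z$ edges $[0,\omega^j]$; and for each $j$ a segment from $m\omega^j$ to the boundary point of $D$ in direction $\omega^j$, where the segments at $j$ and $j+z/2$ join (through the antipodal identification) into a single edge between $m\omega^j$ and $m\omega^{j+z/2}$. $E$ is the edge set of $Pog_h$. A strong $O$-join of $Pog_h$ is a set $F\subseteq E$ such that for every vertex $v$ the number of $F$-edges incident to $v$ has the parity of $\deg v$, and for every face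 $f$ the number of $F$-edges on the boundary of $f$ has the parity of the length of $f$. $V_{12}$ is the set of subsets $p\subseteq E$ that are either the set of edges incident to a vertex of $Pog_h$ of degree 3 or 4, or the set of boundary edges of a face of $Pog_h$ of length 3 or 4. -}

module Defs where

open import Data.Bool using (Bool; true; false; if_then_else_; _∨_; not)
open import Data.Nat using (ℕ; zero; suc; _+_; _∸_; _%_; ⌊_/2⌋)
open import Data.Nat.DivMod using (_mod_)
import Data.Nat.Properties as ℕP
open import Data.Fin using (Fin; toℕ; inject₁; fromℕ; _↑ˡ_; _↑ʳ_)
import Data.Fin.Properties as FinP
open import Data.Integer as ℤ using (ℤ; +_; _-_; _≤_)
open import Data.List using (List; []; _∷_; map; concatMap; filter; length; foldr; allFin)
open import Data.Product using (Σ; _×_; _,_)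
open import Data.Sum using (_⊎_)
open import Relation.Nullary using (Dec; yes; no; ¬_)
open import Relation.Nullary.Decidable using (isYes)
open import Relation.Binary.PropositionalEquality using (_≡_; refl; cong; cong₂)

-- Parametrisation: h = N t / 2 with N t = t + 2, so h ranges over
-- {1, 3/2, 2, 5/2, ...} as t ranges over ℕ.

N : ℕ → ℕ
N t = suc (suc t)

z : ℕ → ℕ
z t = N t + N t

m : ℕ → ℕ          -- m = ⌊h⌋ = ⌊ N / 2 ⌋  (definitionally  suc ⌊ t /2⌋ ≥ 1)
m t = ⌊ N t /2⌋

HalfInt : ℕ → Set
HalfInt t = N t % 2 ≡ 1

next : ∀ {t} → Fin (z t) → Fin (z t)
next {t} j = (suc (toℕ j)) mod (z t)

-- Vertices:  ring i j  is the point (i+1) ω^j  (i : Fin m, so radius 1..m);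
-- centre is the vertex 0, present only when h is a half-integer.

data Vtx (t : ℕ) : Set where
  ring   : Fin (m t) → Fin (z t) → Vtx t
  centre : HalfInt t → Vtx t

top : ∀ t → Fin (m t)
top t = fromℕ ⌊ t /2⌋

-- Edges.
--  orb i j   : orbital edge [(i+1)ω^j, (i+1)ω^{j+1}]
--  rad i j   : radial edge  [(i+1)ω^j, (i+2)ω^j]   (i+1 < m)
--  spoke p j : [0, ω^j]   (h half-integer)
--  bnd j     : (j < z/2 = N) the edge through the cross-cap joining
--              m ω^j and m ω^{j+z/2}

data Edge (t : ℕ) : Set where
  orb   : Fin (m t) → Fin (z t) → Edge t
  rad   : Fin ⌊ t /2⌋ → Fin (z t) → Edge t
  spoke : HalfInt t → Fin (z t) → Edge t
  bnd   : Fin (N t) → Edge t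

ends : ∀ {t} → Edge t → Vtx t × Vtx t
ends         (orb i j)   = ring i j , ring i (next j)
ends         (rad i j)   = ring (inject₁ i) j , ring (Data.Fin.suc i) j
ends         (spoke p j) = centre p , ring Data.Fin.zero j
ends {t}     (bnd j)     = ring (top t) (j ↑ˡ N t) , ring (top t) (N t ↑ʳ j)

pairs : ∀ {a b} → List (Fin a × Fin b)
pairs {a} {b} = concatMap (λ i → map (λ j → i , j) (allFin b)) (allFin a)

halfInt? : ∀ t → Dec (HalfInt t)
halfInt? t = N t % 2 ℕP.≟ 1

allEdges : ∀ t → List (Edge t)
allEdges t =
     map (λ { (i , j) → orb i j }) pairs
  ++ map (λ { (i , j) → rad i j }) pairs
  ++ spokes (halfInt? t)
  ++ map bnd (allFin (N t))
  where
    open Data.List using (_++_)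
    spokes : Dec (HalfInt t) → List (Edge t)
    spokes (yes p) = map (spoke p) (allFin (z t))
    spokes (no _)  = []

_≟V_ : ∀ {t} (u v : Vtx t) → Dec (u ≡ v)
ring i j ≟V ring i' j' with i FinP.≟ i' | j FinP.≟ j'
... | yes refl | yes refl = yes refl
... | no ne    | _        = no (λ { refl → ne refl })
... | yes _    | no ne    = no (λ { refl → ne refl })
ring _ _ ≟V centre _ = no (λ ())
centre _ ≟V ring _ _ = no (λ ())
centre p ≟V centre q with ℕP.≡-irrelevant p q
... | refl = yes refl

incident : ∀ {t} → Vtx t → Edge t → Bool
incident v e with ends e
... | (a , b) = isYes (v ≟V a) ∨ isYes (v ≟V b)

star : ∀ {t} → Vtx t → List (Edge t)
star {t} v = filter (λ e → Relation.Nullary.Decidable.T? (incident v e)) (allEdges t)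
  where import Relation.Nullary.Decidable

deg : ∀ {t} → Vtx t → ℕ
deg v = length (star v)

-- Faces of the cellular embedding in RP².
--  tri p j  : triangle 0, ω^j, ω^{j+1}                    (h half-integer)
--  disk p   : inner face bounded by the unit orbital cycle (h integer)
--  quad i j : (i+1)ω^j,(i+1)ω^{j+1},(i+2)ω^{j+1},(i+2)ω^j
--  outer j  : (j < z/2) the face outside ring m between directions j, j+1,
--             glued through the cross-cap to the one between j+z/2, j+1+z/2

data Face (t : ℕ) : Set where
  tri   : HalfInt t → Fin (z t) → Face t
  disk  : N t % 2 ≡ 0 → Face t
  quad  : Fin ⌊ t /2⌋ → Fin (z t) → Face t
  outer : Fin (N t) → Face t

-- boundary edge set of a face (listed without repetition); its length is
-- the length of the face
faceEdges : ∀ {t} → Face t → List (Edge t)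
faceEdges     (tri p j)  = spoke p j ∷ orb Data.Fin.zero j ∷ spoke p (next j) ∷ []
faceEdges {t} (disk _)   = map (orb Data.Fin.zero) (allFin (z t))
faceEdges     (quad i j) = orb (inject₁ i) j ∷ rad i (next j) ∷ orb (Data.Fin.suc i) j ∷ rad i j ∷ []
faceEdges {t} (outer j)  =
  orb (top t) (j ↑ˡ N t) ∷ bnd ((suc (toℕ j)) mod (N t)) ∷
  orb (top t) (N t ↑ʳ j) ∷ bnd j ∷ []

faceLength : ∀ {t} → Face t → ℕ
faceLength f = length (faceEdges f)

count : ∀ {t} → (Edge t → Bool) → List (Edge t) → ℕ
count F es = length (filter (λ e → Relation.Nullary.Decidable.T? (F e)) es)
  where import Relation.Nullary.Decidable

sumℤ : ∀ {t} → (Edge t → ℤ) → List (Edge t) → ℤ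
sumℤ x = foldr (λ e acc → x e ℤ.+ acc) (+ 0)

StrongOJoin : ∀ t → (Edge t → Bool) → Set
StrongOJoin t F =
    (∀ (v : Vtx t) → count F (star v) % 2 ≡ deg v % 2)
  × (∀ (f : Face t) → count F (faceEdges f) % 2 ≡ faceLength f % 2)

χ : ∀ {t} → (Edge t → Bool) → Edge t → ℤ
χ F e = if F e then + 1 else + 0

Is3or4 : ℕ → Set
Is3or4 k = (k ≡ 3) ⊎ (k ≡ 4)

V12 : ∀ t → List (Edge t) → Set
V12 t p =
    (Σ (Vtx t) λ v → (p ≡ star v) × Is3or4 (deg v))
  ⊎ (Σ (Face t) λ f → (p ≡ faceEdges f) × Is3or4 (faceLength f))

-- membership in P₂'.  A subset q ⊆ p is described by a selector s : E → Bool
-- (q = { e ∈ p | s e }); every subset of p arises this way.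
InP2' : ∀ t → (Edge t → ℤ) → Set
InP2' t x =
    (∀ (e : Edge t) → (+ 0 ≤ x e) × (x e ≤ + 1))
  × (∀ (p : List (Edge t)) → V12 t p → ∀ (s : Edge t → Bool) →
       (length p ∸ count s p) % 2 ≡ 1 →
       sumℤ x (filter (λ e → Relation.Nullary.Decidable.T? (s e)) p)
         - sumℤ x (filter (λ e → Relation.Nullary.Decidable.T? (not (s e))) p)
         ≤ + (count s p) - + 1)
  where import Relation.Nullary.Decidable

-- For a 0/1 vector χ F, the inequality of P₂' for p ∈ V₁₂ and q = {e ∈ p | s e} says precisely
-- that q ≠ F ∩ p: its left-hand side is |q| minus the number of edges of p on which s and F
-- disagree. As |p| − |q| is odd, every such q differs from F ∩ p exactly when |F ∩ p| ≡ |p|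
-- (mod 2); hence the integer points of P₂' are the χ F with the strong O-join parity condition
-- at every vertex of degree 3 or 4 and every face of length 3 or 4. All vertices except the
-- centre and all faces except the central disk are of this kind. The centre is settled by the
-- handshake lemma: summed over all vertices both sides are even, every edge having two ends.
-- The disk is settled by telescoping: the quadrilaterals between consecutive orbits show that
-- all orbits carry F-edges of the same parity, and the faces through the crosscap pair the two
-- halves of the outermost orbit, so that orbit carries an even number.

module Submission where

open import Defs
import Data.Nat.Properties as ℕP

open import Algebra.Properties.CommutativeSemigroup ℕP.+-commutativeSemigroup
  using () renaming (interchange to +-interchange)
open import Algebra.Properties.Semiring.Sum ℕP.+-*-semiring
  using (sum-syntax; sum-cong-≗; ∑-distrib-+; *-distribˡ-sum; sum-init-last; sum-replicate-zero)
open import Data.Bool using (Bool; true; false; not; _∧_; _xor_)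
open import Data.Bool.Properties using (not-involutive; not-distribˡ-xor; xor-same; xor-identityʳ)
open import Data.Empty using (⊥-elim)
open import Data.Fin as Fin using (Fin; toℕ; inject₁; fromℕ; _↑ˡ_; _↑ʳ_)
import Data.Fin.Properties as FinP
open import Data.Fin.Relation.Unary.Top using (view; ‵fromℕ; ‵inject₁)
open import Data.Integer as ℤ using (ℤ; +_; _⊖_)
import Data.Integer.Properties as ℤP
open import Data.List using (List; []; _∷_; map; concatMap; filter; length; allFin; tabulate; _++_)
import Data.List.Properties as LP
open import Data.Nat using (ℕ; zero; suc; _+_; _*_; _∸_; _%_; _≤_; z≤n; s≤s; ⌊_/2⌋)
open import Data.Nat.DivMod using (_mod_; [m+n]%n≡m%n; m<n⇒m%n≡m; n%n≡0)
open import Data.Product using (Σ; _×_; _,_; proj₁; proj₂)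
open import Data.Sum using (inj₁; inj₂)
open import Function using (_∘_; _⇔_; mk⇔)
open import Relation.Binary.PropositionalEquality
open import Relation.Nullary using (Dec; yes; no; ¬_)
open import Relation.Nullary.Decidable using (isYes; T?; ⌊⌋-map′; isYes≗does; dec-true)

𝟙 : Bool → ℕ
𝟙 true  = 1
𝟙 false = 0

𝟙-injective : ∀ {x y} → 𝟙 x ≡ 𝟙 y → x ≡ y
𝟙-injective {true}  {true}  _ = refl
𝟙-injective {false} {false} _ = refl

𝟙-∧ : ∀ x y → 𝟙 (x ∧ y) ≡ 𝟙 x * 𝟙 y
𝟙-∧ true  y = sym (ℕP.*-identityˡ (𝟙 y))
𝟙-∧ false y = refl

odd : ℕ → Bool
odd zero    = false
odd (suc n) = not (odd n)

odd-+ : ∀ m n → odd (m + n) ≡ odd m xor odd n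
odd-+ zero    n = refl
odd-+ (suc m) n = trans (cong not (odd-+ m n)) (not-distribˡ-xor (odd m) (odd n))

odd-double : ∀ n → odd (n + n) ≡ false
odd-double n = trans (odd-+ n n) (xor-same (odd n))

odd-2* : ∀ n → odd (2 * n) ≡ false
odd-2* n = trans (cong odd (cong (_+_ n) (ℕP.+-identityʳ n))) (odd-double n)

n%2≡𝟙[odd-n] : ∀ n → n % 2 ≡ 𝟙 (odd n)
n%2≡𝟙[odd-n] zero          = refl
n%2≡𝟙[odd-n] (suc zero)    = refl
n%2≡𝟙[odd-n] (suc (suc n)) = begin
  (2 + n) % 2          ≡⟨ cong (_% 2) (ℕP.+-comm 2 n) ⟩
  (n + 2) % 2          ≡⟨ [m+n]%n≡m%n n 2 ⟩
  n % 2                ≡⟨ n%2≡𝟙[odd-n] n ⟩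
  𝟙 (odd n)            ≡⟨ cong 𝟙 (sym (not-involutive (odd n))) ⟩
  𝟙 (odd (2 + n))      ∎
  where open ≡-Reasoning

%2≡⇒odd≡ : ∀ m n → m % 2 ≡ n % 2 → odd m ≡ odd n
%2≡⇒odd≡ m n eq = 𝟙-injective (trans (sym (n%2≡𝟙[odd-n] m)) (trans eq (n%2≡𝟙[odd-n] n)))

odd≡⇒%2≡ : ∀ m n → odd m ≡ odd n → m % 2 ≡ n % 2
odd≡⇒%2≡ m n eq = trans (n%2≡𝟙[odd-n] m) (trans (cong 𝟙 eq) (sym (n%2≡𝟙[odd-n] n)))

xor≡false⇒≡ : ∀ x y → x xor y ≡ false → x ≡ y
xor≡false⇒≡ false false _ = refl
xor≡false⇒≡ true  true  _ = refl

∑-zero : ∀ {n} {f : Fin n → ℕ} → (∀ i → f i ≡ 0) → ∑[ i < n ] f i ≡ 0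
∑-zero {n} f≡0 = trans (sum-cong-≗ f≡0) (sum-replicate-zero n)

∑-↑-split : ∀ a b (g : Fin (a + b) → ℕ) →
            ∑[ k < a + b ] g k ≡ ∑[ k < a ] g (k ↑ˡ b) + ∑[ k < b ] g (a ↑ʳ k)
∑-↑-split zero    b g = refl
∑-↑-split (suc a) b g =
  trans (cong (_+_ (g Fin.zero)) (∑-↑-split a b (g ∘ Fin.suc))) (sym (ℕP.+-assoc (g Fin.zero) _ _))

odd-∑-even : ∀ {n} (f : Fin n → ℕ) → (∀ i → odd (f i) ≡ false) → odd (∑[ i < n ] f i) ≡ false
odd-∑-even {zero}  f even = refl
odd-∑-even {suc n} f even =
  trans (odd-+ (f Fin.zero) _) (cong₂ _xor_ (even Fin.zero) (odd-∑-even (f ∘ Fin.suc) (even ∘ Fin.suc)))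

[a+b]+[c+d]≡[a+d]+[c+b] : ∀ a b c d → (a + b) + (c + d) ≡ (a + d) + (c + b)
[a+b]+[c+d]≡[a+d]+[c+b] a b c d = begin
  (a + b) + (c + d)  ≡⟨ cong (_+_ (a + b)) (ℕP.+-comm c d) ⟩
  (a + b) + (d + c)  ≡⟨ +-interchange a b d c ⟩
  (a + d) + (b + c)  ≡⟨ cong (_+_ (a + d)) (ℕP.+-comm b c) ⟩
  (a + d) + (c + b)  ∎
  where open ≡-Reasoning

telescope : ∀ {B : Set} k (a : Fin (suc k) → B) →
            (∀ i → a (inject₁ i) ≡ a (Fin.suc i)) → a Fin.zero ≡ a (fromℕ k)
telescope zero    a step = refl
telescope (suc k) a step = trans (step Fin.zero) (telescope k (a ∘ Fin.suc) (step ∘ Fin.suc))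

variable
  A B : Set

∑ᴸ : (A → ℕ) → List A → ℕ
∑ᴸ g []       = 0
∑ᴸ g (x ∷ xs) = g x + ∑ᴸ g xs

∑ᴸ-cong : {f g : A → ℕ} → (∀ x → f x ≡ g x) → ∀ xs → ∑ᴸ f xs ≡ ∑ᴸ g xs
∑ᴸ-cong eq []       = refl
∑ᴸ-cong eq (x ∷ xs) = cong₂ _+_ (eq x) (∑ᴸ-cong eq xs)

∑ᴸ-++ : ∀ (g : A → ℕ) xs ys → ∑ᴸ g (xs ++ ys) ≡ ∑ᴸ g xs + ∑ᴸ g ys
∑ᴸ-++ g []       ys = refl
∑ᴸ-++ g (x ∷ xs) ys = trans (cong (_+_ (g x)) (∑ᴸ-++ g xs ys)) (sym (ℕP.+-assoc (g x) _ _))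

∑ᴸ-map : ∀ (g : B → ℕ) (f : A → B) xs → ∑ᴸ g (map f xs) ≡ ∑ᴸ (g ∘ f) xs
∑ᴸ-map g f []       = refl
∑ᴸ-map g f (x ∷ xs) = cong (_+_ (g (f x))) (∑ᴸ-map g f xs)

∑ᴸ-concatMap : ∀ (g : B → ℕ) (f : A → List B) xs →
               ∑ᴸ g (concatMap f xs) ≡ ∑ᴸ (∑ᴸ g ∘ f) xs
∑ᴸ-concatMap g f []       = refl
∑ᴸ-concatMap g f (x ∷ xs) =
  trans (∑ᴸ-++ g (f x) (concatMap f xs)) (cong (_+_ (∑ᴸ g (f x))) (∑ᴸ-concatMap g f xs))

∑ᴸ-distrib-+ : ∀ (f g : A → ℕ) xs → ∑ᴸ (λ x → f x + g x) xs ≡ ∑ᴸ f xs + ∑ᴸ g xs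
∑ᴸ-distrib-+ f g []       = refl
∑ᴸ-distrib-+ f g (x ∷ xs) =
  trans (cong (_+_ (f x + g x)) (∑ᴸ-distrib-+ f g xs)) (+-interchange (f x) (g x) _ _)

*-distribˡ-∑ᴸ : ∀ c (g : A → ℕ) xs → c * ∑ᴸ g xs ≡ ∑ᴸ (λ x → c * g x) xs
*-distribˡ-∑ᴸ c g []       = ℕP.*-zeroʳ c
*-distribˡ-∑ᴸ c g (x ∷ xs) =
  trans (ℕP.*-distribˡ-+ c (g x) _) (cong (_+_ (c * g x)) (*-distribˡ-∑ᴸ c g xs))

*-distribʳ-∑ᴸ : ∀ c (g : A → ℕ) xs → ∑ᴸ g xs * c ≡ ∑ᴸ (λ x → g x * c) xs
*-distribʳ-∑ᴸ c g xs = trans (ℕP.*-comm (∑ᴸ g xs) c)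
  (trans (*-distribˡ-∑ᴸ c g xs) (∑ᴸ-cong (λ x → ℕP.*-comm c (g x)) xs))

∑ᴸ-comm : ∀ (g : A → B → ℕ) xs ys →
          ∑ᴸ (λ x → ∑ᴸ (g x) ys) xs ≡ ∑ᴸ (λ y → ∑ᴸ (λ x → g x y) xs) ys
∑ᴸ-comm g []       ys = sym (∑ᴸ-zero ys)
  where
  ∑ᴸ-zero : (ys : List B) → ∑ᴸ (λ _ → 0) ys ≡ 0
  ∑ᴸ-zero []       = refl
  ∑ᴸ-zero (_ ∷ ys) = ∑ᴸ-zero ys
∑ᴸ-comm g (x ∷ xs) ys =
  trans (cong (_+_ (∑ᴸ (g x) ys)) (∑ᴸ-comm g xs ys)) (sym (∑ᴸ-distrib-+ (g x) _ ys))

odd-∑ᴸ-cong : ∀ (f g : A → ℕ) → (∀ x → odd (f x) ≡ odd (g x)) →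
              ∀ xs → odd (∑ᴸ f xs) ≡ odd (∑ᴸ g xs)
odd-∑ᴸ-cong f g eq []       = refl
odd-∑ᴸ-cong f g eq (x ∷ xs) = begin
  odd (f x + ∑ᴸ f xs)           ≡⟨ odd-+ (f x) _ ⟩
  odd (f x) xor odd (∑ᴸ f xs)   ≡⟨ cong₂ _xor_ (eq x) (odd-∑ᴸ-cong f g eq xs) ⟩
  odd (g x) xor odd (∑ᴸ g xs)   ≡⟨ odd-+ (g x) _ ⟨
  odd (g x + ∑ᴸ g xs)           ∎
  where open ≡-Reasoning

∑ᴸ-tabulate : ∀ n (g : A → ℕ) (f : Fin n → A) → ∑ᴸ g (tabulate f) ≡ ∑[ i < n ] g (f i)
∑ᴸ-tabulate zero    g f = refl
∑ᴸ-tabulate (suc n) g f = cong (_+_ (g (f Fin.zero))) (∑ᴸ-tabulate n g (f ∘ Fin.suc))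

∑ᴸ-map-allFin : ∀ n (g : A → ℕ) (f : Fin n → A) → ∑ᴸ g (map f (allFin n)) ≡ ∑[ i < n ] g (f i)
∑ᴸ-map-allFin n g f = trans (∑ᴸ-map g f (allFin n)) (∑ᴸ-tabulate n (g ∘ f) (λ i → i))

∑ᴸ-map-pairs : ∀ a b (g : A → ℕ) (f : Fin a × Fin b → A) →
               ∑ᴸ g (map f pairs) ≡ ∑[ i < a ] ∑[ j < b ] g (f (i , j))
∑ᴸ-map-pairs a b g f = begin
  ∑ᴸ g (map f pairs)
    ≡⟨ ∑ᴸ-map g f pairs ⟩
  ∑ᴸ (g ∘ f) (concatMap (λ i → map (i ,_) (allFin b)) (allFin a))
    ≡⟨ ∑ᴸ-concatMap (g ∘ f) _ (allFin a) ⟩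
  ∑ᴸ (λ i → ∑ᴸ (g ∘ f) (map (i ,_) (allFin b))) (allFin a)
    ≡⟨ ∑ᴸ-tabulate a _ (λ i → i) ⟩
  ∑[ i < a ] ∑ᴸ (g ∘ f) (map (i ,_) (allFin b))
    ≡⟨ sum-cong-≗ (λ i → ∑ᴸ-map-allFin b (g ∘ f) (i ,_)) ⟩
  ∑[ i < a ] ∑[ j < b ] g (f (i , j)) ∎
  where open ≡-Reasoning

∑ᴸ-const-1 : (xs : List A) → ∑ᴸ (λ _ → 1) xs ≡ length xs
∑ᴸ-const-1 []       = refl
∑ᴸ-const-1 (_ ∷ xs) = cong suc (∑ᴸ-const-1 xs)

odd-∑ᴸ-snoc : ∀ (f : A → ℕ) xs x → odd (∑ᴸ f (xs ++ x ∷ [])) ≡ odd (∑ᴸ f xs) xor odd (f x)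
odd-∑ᴸ-snoc f xs x = trans
  (cong odd (trans (∑ᴸ-++ f xs (x ∷ [])) (cong (_+_ (∑ᴸ f xs)) (ℕP.+-identityʳ (f x)))))
  (odd-+ (∑ᴸ f xs) (f x))

module _ {t : ℕ} where

  count-∑ᴸ : ∀ (F : Edge t → Bool) es → count F es ≡ ∑ᴸ (𝟙 ∘ F) es
  count-∑ᴸ F []       = refl
  count-∑ᴸ F (e ∷ es) with F e
  ... | true  = cong suc (count-∑ᴸ F es)
  ... | false = count-∑ᴸ F es

  count-cong : ∀ {F G : Edge t → Bool} → (∀ e → F e ≡ G e) → ∀ es → count F es ≡ count G es
  count-cong {F} {G} eq es =
    trans (count-∑ᴸ F es) (trans (∑ᴸ-cong (cong 𝟙 ∘ eq) es) (sym (count-∑ᴸ G es)))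

  count-true : ∀ es → count {t} (λ _ → true) es ≡ length es
  count-true []       = refl
  count-true (_ ∷ es) = cong suc (count-true es)

  count-false : ∀ es → count {t} (λ _ → false) es ≡ 0
  count-false []       = refl
  count-false (_ ∷ es) = count-false es

  count-filter : ∀ (F G : Edge t → Bool) es → count F (filter (T? ∘ G) es) ≡ count (λ e → G e ∧ F e) es
  count-filter F G []       = refl
  count-filter F G (e ∷ es) with G e
  ... | false = count-filter F G es
  ... | true with F e
  ...   | true  = cong suc (count-filter F G es)
  ...   | false = count-filter F G es

  count+count-not : ∀ (s : Edge t → Bool) es → count s es + count (not ∘ s) es ≡ length es
  count+count-not s []       = refl
  count+count-not s (e ∷ es) with s e
  ... | true  = cong suc (count+count-not s es)
  ... | false = trans (ℕP.+-suc (count s es) _) (cong suc (count+count-not s es))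

  sumℤ-χ-filter : ∀ (F s : Edge t → Bool) es →
                  sumℤ (χ F) (filter (T? ∘ s) es) ≡ + count (λ e → s e ∧ F e) es
  sumℤ-χ-filter F s []       = refl
  sumℤ-χ-filter F s (e ∷ es) with s e
  ... | false = sumℤ-χ-filter F s es
  ... | true with F e
  ...   | true  = cong (ℤ._+_ (+ 1)) (sumℤ-χ-filter F s es)
  ...   | false = trans (ℤP.+-identityˡ _) (sumℤ-χ-filter F s es)

  count-+ : ∀ (F G : Edge t → Bool) es → count F es + count G es ≡ ∑ᴸ (λ e → 𝟙 (F e) + 𝟙 (G e)) es
  count-+ F G es =
    trans (cong₂ _+_ (count-∑ᴸ F es) (count-∑ᴸ G es)) (sym (∑ᴸ-distrib-+ (𝟙 ∘ F) (𝟙 ∘ G) es))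

  length∸count : ∀ (s : Edge t → Bool) es → length es ∸ count s es ≡ count (not ∘ s) es
  length∸count s es =
    trans (cong (_∸ count s es) (sym (count+count-not s es))) (ℕP.m+n∸m≡n (count s es) _)

  odd-complement : ∀ s es → (length es ∸ count s es) % 2 ≡ 1 → odd (count (not ∘ s) es) ≡ true
  odd-complement s es eq = %2≡⇒odd≡ (count (not ∘ s) es) 1 (trans (cong (_% 2) (sym (length∸count s es))) eq)

  odd-complement⁻¹ : ∀ s es → odd (count (not ∘ s) es) ≡ true → (length es ∸ count s es) % 2 ≡ 1
  odd-complement⁻¹ s es eq = trans (cong (_% 2) (length∸count s es)) (odd≡⇒%2≡ (count (not ∘ s) es) 1 eq)

-- The inequalities of P₂' at a 0/1 vector

excess : ∀ {t} → (Edge t → ℤ) → (Edge t → Bool) → List (Edge t) → ℤ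
excess x s p = sumℤ x (filter (T? ∘ s) p) ℤ.- sumℤ x (filter (T? ∘ not ∘ s) p)

module Mismatch {t} (F s : Edge t → Bool) (p : List (Edge t)) where

  mismatch : ℕ
  mismatch = count (λ e → s e xor F e) p

  excess-χ : excess (χ F) s p ≡ count s p ⊖ mismatch
  excess-χ = begin
    excess (χ F) s p                      ≡⟨ cong₂ ℤ._-_ (sumℤ-χ-filter F s p) (sumℤ-χ-filter F (not ∘ s) p) ⟩
    + sF ℤ.- + nsF                         ≡⟨ ℤP.[+m]-[+n]≡m⊖n sF nsF ⟩
    sF ⊖ nsF                               ≡⟨ ℤP.+-cancelˡ-⊖ mismatch sF nsF ⟨
    (mismatch + sF) ⊖ (mismatch + nsF)     ≡⟨ cong₂ _⊖_ tally (ℕP.+-comm mismatch nsF) ⟩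
    (nsF + count s p) ⊖ (nsF + mismatch)   ≡⟨ ℤP.+-cancelˡ-⊖ nsF (count s p) mismatch ⟩
    count s p ⊖ mismatch                   ∎
    where
    open ≡-Reasoning
    sF nsF : ℕ
    sF  = count (λ e → s e ∧ F e) p
    nsF = count (λ e → not (s e) ∧ F e) p
    tally : mismatch + sF ≡ nsF + count s p
    tally = trans (count-+ _ _ p) (trans (∑ᴸ-cong (λ e → pointwise (s e) (F e)) p) (sym (count-+ _ _ p)))
      where
      pointwise : ∀ x y → 𝟙 (x xor y) + 𝟙 (x ∧ y) ≡ 𝟙 (not x ∧ y) + 𝟙 x
      pointwise true  true  = refl
      pointwise true  false = refl
      pointwise false true  = refl
      pointwise false false = refl

  mismatch-parity : odd (count F p) xor (odd mismatch xor odd (count (not ∘ s) p)) ≡ odd (length p)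
  mismatch-parity = begin
    odd (count F p) xor (odd mismatch xor odd (count (not ∘ s) p))
      ≡⟨ cong (odd (count F p) xor_) (odd-+ mismatch _) ⟨
    odd (count F p) xor odd (mismatch + count (not ∘ s) p)
      ≡⟨ odd-+ (count F p) _ ⟨
    odd (count F p + (mismatch + count (not ∘ s) p))
      ≡⟨ cong odd (cong₂ _+_ (count-∑ᴸ F p) (count-+ _ _ p)) ⟩
    odd (∑ᴸ (𝟙 ∘ F) p + ∑ᴸ (λ e → 𝟙 (s e xor F e) + 𝟙 (not (s e))) p)
      ≡⟨ cong odd (∑ᴸ-distrib-+ _ _ p) ⟨
    odd (∑ᴸ (λ e → 𝟙 (F e) + (𝟙 (s e xor F e) + 𝟙 (not (s e)))) p)
      ≡⟨ odd-∑ᴸ-cong _ (λ _ → 1) (λ e → pointwise (s e) (F e)) p ⟩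
    odd (∑ᴸ (λ _ → 1) p)
      ≡⟨ cong odd (∑ᴸ-const-1 p) ⟩
    odd (length p) ∎
    where
    open ≡-Reasoning
    pointwise : ∀ x y → odd (𝟙 y + (𝟙 (x xor y) + 𝟙 (not x))) ≡ true
    pointwise true  true  = refl
    pointwise true  false = refl
    pointwise false true  = refl
    pointwise false false = refl

  mismatch-odd : odd (count F p) ≡ odd (length p) → odd (count (not ∘ s) p) ≡ true → odd mismatch ≡ true
  mismatch-odd parity complement-odd = forced (odd (count F p)) (odd mismatch) (begin
    odd (count F p) xor (odd mismatch xor true)
      ≡⟨ cong (λ c → odd (count F p) xor (odd mismatch xor c)) complement-odd ⟨
    odd (count F p) xor (odd mismatch xor odd (count (not ∘ s) p))
      ≡⟨ mismatch-parity ⟩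
    odd (length p)
      ≡⟨ parity ⟨
    odd (count F p) ∎)
    where
    open ≡-Reasoning
    forced : ∀ a d → a xor (d xor true) ≡ a → d ≡ true
    forced true  true  _ = refl
    forced false true  _ = refl

module _ {t} (F : Edge t → Bool) (p : List (Edge t)) where

  parity⇒constraint : odd (count F p) ≡ odd (length p) → ∀ s → (length p ∸ count s p) % 2 ≡ 1 →
                      excess (χ F) s p ℤ.≤ + count s p ℤ.- + 1
  parity⇒constraint parity s complement-odd = begin
    excess (χ F) s p       ≡⟨ excess-χ ⟩
    count s p ⊖ mismatch   ≤⟨ ℤP.⊖-monoʳ-≥-≤ (count s p) mismatch≥1 ⟩
    count s p ⊖ 1          ≡⟨ ℤP.[+m]-[+n]≡m⊖n (count s p) 1 ⟨
    + count s p ℤ.- + 1    ∎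
    where
    open ℤP.≤-Reasoning
    open Mismatch F s p
    odd⇒≥1 : ∀ n → odd n ≡ true → 1 ≤ n
    odd⇒≥1 (suc n) _ = s≤s z≤n
    mismatch≥1 : 1 ≤ mismatch
    mismatch≥1 = odd⇒≥1 mismatch (mismatch-odd parity (odd-complement s p complement-odd))

  constraint⇒parity : ((length p ∸ count F p) % 2 ≡ 1 → excess (χ F) F p ℤ.≤ + count F p ℤ.- + 1) →
                      odd (count F p) ≡ odd (length p)
  constraint⇒parity constraint = begin
    odd (count F p)
      ≡⟨ xor-identityʳ _ ⟨
    odd (count F p) xor false
      ≡⟨ cong (odd (count F p) xor_) complement-even ⟨
    odd (count F p) xor odd (count (not ∘ F) p)
      ≡⟨ cong (λ d → odd (count F p) xor (odd d xor odd (count (not ∘ F) p))) mismatch≡0 ⟨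
    odd (count F p) xor (odd mismatch xor odd (count (not ∘ F) p))
      ≡⟨ mismatch-parity ⟩
    odd (length p) ∎
    where
    open ≡-Reasoning
    open Mismatch F F p
    mismatch≡0 : mismatch ≡ 0
    mismatch≡0 = trans (count-cong (λ e → xor-same (F e)) p) (count-false p)
    violated : ¬ (excess (χ F) F p ℤ.≤ + count F p ℤ.- + 1)
    violated le = ℤP.<-irrefl refl (ℤP.≤-<-trans
      (subst (ℤ._≤ + count F p ℤ.- + 1) (trans excess-χ (cong (count F p ⊖_) mismatch≡0)) le)
      (subst (ℤ._< + count F p) (sym (ℤP.[+m]-[+n]≡m⊖n (count F p) 1)) (ℤP.m⊖1+n<m (count F p) 1)))
    complement-even : odd (count (not ∘ F) p) ≡ false
    complement-even with odd (count (not ∘ F) p) in eq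
    ... | false = refl
    ... | true  = ⊥-elim (violated (constraint (odd-complement⁻¹ F p eq)))

sumℤ-cong : ∀ {t} {x y : Edge t → ℤ} → (∀ e → x e ≡ y e) → ∀ es → sumℤ x es ≡ sumℤ y es
sumℤ-cong eq []       = refl
sumℤ-cong eq (e ∷ es) = cong₂ ℤ._+_ (eq e) (sumℤ-cong eq es)

excess-cong : ∀ {t} {x y : Edge t → ℤ} → (∀ e → x e ≡ y e) → ∀ s p → excess x s p ≡ excess y s p
excess-cong eq s p =
  cong₂ ℤ._-_ (sumℤ-cong eq (filter (T? ∘ s) p)) (sumℤ-cong eq (filter (T? ∘ not ∘ s) p))

χ-bounds : ∀ {t} (F : Edge t → Bool) e → (+ 0 ℤ.≤ χ F e) × (χ F e ℤ.≤ + 1)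
χ-bounds F e with F e
... | true  = ℤ.+≤+ z≤n , ℤ.+≤+ (s≤s z≤n)
... | false = ℤ.+≤+ z≤n , ℤ.+≤+ z≤n

χ-of-01 : ∀ {t} (x : Edge t → ℤ) → (∀ e → (+ 0 ℤ.≤ x e) × (x e ℤ.≤ + 1)) →
          ∀ e → x e ≡ χ (λ e → isYes (x e ℤ.≟ + 1)) e
χ-of-01 x bounds e with x e ℤ.≟ + 1 | bounds e
... | yes x≡1 | _          = x≡1
... | no  x≢1 | 0≤x , x≤1 = zero-or-one (x e) x≢1 0≤x x≤1
  where
  zero-or-one : ∀ y → y ≢ + 1 → + 0 ℤ.≤ y → y ℤ.≤ + 1 → y ≡ + 0
  zero-or-one (+ 0)               _   _ _                    = refl
  zero-or-one (+ 1)               y≢1 _ _                    = ⊥-elim (y≢1 refl)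
  zero-or-one (+ suc (suc _))     _   _ (ℤ.+≤+ (s≤s ()))

δ : ∀ {n} → Fin n → Fin n → ℕ
δ i j = 𝟙 (isYes (i FinP.≟ j))

∑-δ : ∀ {n} (i : Fin n) → ∑[ j < n ] δ i j ≡ 1
∑-δ {suc n} Fin.zero    = cong suc (sum-replicate-zero n)
∑-δ {suc n} (Fin.suc i) =
  trans (sum-cong-≗ (λ j → cong 𝟙 (⌊⌋-map′ (cong Fin.suc) FinP.suc-injective (i FinP.≟ j)))) (∑-δ i)

∑-*-δ : ∀ {n} c (i : Fin n) → ∑[ j < n ] (c * δ i j) ≡ c
∑-*-δ c i = trans (sym (*-distribˡ-sum c (δ i))) (trans (cong (c *_) (∑-δ i)) (ℕP.*-identityʳ c))

-- next, and the successor mod N t used by the outer faces, are both instances of rotate.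
rotate : ∀ {k} → Fin (suc k) → Fin (suc k)
rotate {k} j = suc (toℕ j) mod suc k

rotate-inject₁ : ∀ {k} (i : Fin k) → rotate (inject₁ i) ≡ Fin.suc i
rotate-inject₁ {k} i = FinP.toℕ-injective (begin
  toℕ (rotate (inject₁ i))        ≡⟨ FinP.toℕ-fromℕ< _ ⟩
  suc (toℕ (inject₁ i)) % suc k   ≡⟨ cong (λ n → suc n % suc k) (FinP.toℕ-inject₁ i) ⟩
  suc (toℕ i) % suc k             ≡⟨ m<n⇒m%n≡m (s≤s (FinP.toℕ<n i)) ⟩
  suc (toℕ i)                     ∎)
  where open ≡-Reasoning

rotate-fromℕ : ∀ k → rotate (fromℕ k) ≡ Fin.zero
rotate-fromℕ k = FinP.toℕ-injective (begin
  toℕ (rotate (fromℕ k))       ≡⟨ FinP.toℕ-fromℕ< _ ⟩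
  suc (toℕ (fromℕ k)) % suc k   ≡⟨ cong (λ n → suc n % suc k) (FinP.toℕ-fromℕ k) ⟩
  suc k % suc k                 ≡⟨ n%n≡0 (suc k) ⟩
  0                             ∎)
  where open ≡-Reasoning

∑-rotate : ∀ {k} (g : Fin (suc k) → ℕ) → ∑[ j < suc k ] g (rotate j) ≡ ∑[ j < suc k ] g j
∑-rotate {k} g = begin
  ∑[ j < suc k ] g (rotate j)
    ≡⟨ sum-init-last (g ∘ rotate) ⟩
  ∑[ i < k ] g (rotate (inject₁ i)) + g (rotate (fromℕ k))
    ≡⟨ cong₂ _+_ (sum-cong-≗ (cong g ∘ rotate-inject₁)) (cong g (rotate-fromℕ k)) ⟩
  ∑[ i < k ] g (Fin.suc i) + g Fin.zero
    ≡⟨ ℕP.+-comm _ (g Fin.zero) ⟩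
  ∑[ j < suc k ] g j ∎
  where open ≡-Reasoning

inject₁≢suc : ∀ {k} (i : Fin k) → inject₁ i ≢ Fin.suc i
inject₁≢suc i eq = ℕP.1+n≢n (sym (trans (sym (FinP.toℕ-inject₁ i)) (cong toℕ eq)))

rotate-≢ : ∀ {k} (j : Fin (suc (suc k))) → rotate j ≢ j
rotate-≢ j eq with view j
rotate-≢ .(fromℕ _)   eq | ‵fromℕ     = FinP.0≢1+n (trans (sym (rotate-fromℕ _)) eq)
rotate-≢ .(inject₁ i) eq | ‵inject₁ i = inject₁≢suc i (sym (trans (sym (rotate-inject₁ i)) eq))

-- Degrees of the ring vertices

module _ {t : ℕ} where

  δᵛ : Vtx t → Vtx t → ℕ
  δᵛ u v = 𝟙 (isYes (u ≟V v))

  δᵛ-ring : ∀ i i' j j' → δᵛ (ring i j) (ring i' j') ≡ δ i i' * δ j j'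
  δᵛ-ring i i' j j' with i FinP.≟ i' | j FinP.≟ j'
  ... | yes refl | yes refl = refl
  ... | yes refl | no _     = refl
  ... | no _     | _        = refl

  δᵛ-centre : ∀ p q → δᵛ (centre p) (centre q) ≡ 1
  δᵛ-centre p q = cong 𝟙 (trans (isYes≗does (centre p ≟V centre q))
                                (dec-true (centre p ≟V centre q) (cong centre (ℕP.≡-irrelevant p q))))

  ∑-δᵛ-ring : ∀ i j i' → ∑[ j' < z t ] δᵛ (ring i j) (ring i' j') ≡ δ i i'
  ∑-δᵛ-ring i j i' = trans (sum-cong-≗ (δᵛ-ring i i' j)) (∑-*-δ (δ i i') j)

  δᵛ-sym : ∀ u v → δᵛ u v ≡ δᵛ v u
  δᵛ-sym u v with u ≟V v | v ≟V u
  ... | yes _    | yes _    = refl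
  ... | no _     | no _     = refl
  ... | yes refl | no v≢u   = ⊥-elim (v≢u refl)
  ... | no u≢v   | yes refl = ⊥-elim (u≢v refl)

  ring-injective : ∀ {i i' j j'} → ring {t} i j ≡ ring i' j' → i ≡ i' × j ≡ j'
  ring-injective refl = refl , refl

  ends-distinct : (e : Edge t) → proj₁ (ends e) ≢ proj₂ (ends e)
  ends-distinct (orb i j)   eq = rotate-≢ j (sym (proj₂ (ring-injective eq)))
  ends-distinct (rad i j)   eq = inject₁≢suc i (proj₁ (ring-injective eq))
  ends-distinct (spoke p j) ()
  ends-distinct (bnd j)     eq = ℕP.m≢1+n+m (toℕ j) (begin
    toℕ j                  ≡⟨ FinP.toℕ-↑ˡ j (N t) ⟨
    toℕ (j ↑ˡ N t)         ≡⟨ cong toℕ (proj₂ (ring-injective eq)) ⟩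
    toℕ (N t ↑ʳ j)         ≡⟨ FinP.toℕ-↑ʳ (N t) j ⟩
    N t + toℕ j            ∎)
    where open ≡-Reasoning

  𝟙-incident : ∀ v (e : Edge t) → 𝟙 (incident v e) ≡ δᵛ v (proj₁ (ends e)) + δᵛ v (proj₂ (ends e))
  𝟙-incident v e with ends e | ends-distinct e
  ... | a , b | a≢b with v ≟V a | v ≟V b
  ... | yes refl | yes refl = ⊥-elim (a≢b refl)
  ... | yes _    | no _     = refl
  ... | no _     | yes _    = refl
  ... | no _     | no _     = refl

  deg≡∑-incidences : ∀ v → deg v ≡ ∑ᴸ (λ e → δᵛ v (proj₁ (ends e)) + δᵛ v (proj₂ (ends e))) (allEdges t)
  deg≡∑-incidences v =
    trans (count-∑ᴸ (incident v) (allEdges t)) (∑ᴸ-cong (𝟙-incident v) (allEdges t))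

spokeSum : ∀ {t} → Dec (HalfInt t) → (Edge t → ℕ) → ℕ
spokeSum {t} (yes p) g = ∑[ j < z t ] g (spoke p j)
spokeSum     (no _)  g = 0

-- The record-pattern lambdas with which allEdges lists orbital and radial edges are
-- definitionally these projection forms, so the lemma applies to allEdges as it stands.
∑ᴸ-ringEdges-++ : ∀ {t} (g : Edge t → ℕ) rest {r} → ∑ᴸ g rest ≡ r →
  ∑ᴸ g (map (λ ij → orb (proj₁ ij) (proj₂ ij)) pairs
        ++ map (λ ij → rad (proj₁ ij) (proj₂ ij)) pairs ++ rest)
  ≡ ∑[ i < m t ] ∑[ j < z t ] g (orb i j) + (∑[ i < ⌊ t /2⌋ ] ∑[ j < z t ] g (rad i j) + r)
∑ᴸ-ringEdges-++ {t} g rest eq =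
  trans (∑ᴸ-++ g (map orb′ pairs) _) (cong₂ _+_ (∑ᴸ-map-pairs (m t) (z t) g orb′)
    (trans (∑ᴸ-++ g (map rad′ pairs) rest) (cong₂ _+_ (∑ᴸ-map-pairs ⌊ t /2⌋ (z t) g rad′) eq)))
  where
  orb′ : Fin (m t) × Fin (z t) → Edge t
  orb′ ij = orb (proj₁ ij) (proj₂ ij)
  rad′ : Fin ⌊ t /2⌋ × Fin (z t) → Edge t
  rad′ ij = rad (proj₁ ij) (proj₂ ij)

∑ᴸ-allEdges : ∀ t (g : Edge t → ℕ) → ∑ᴸ g (allEdges t) ≡
  ∑[ i < m t ] ∑[ j < z t ] g (orb i j) + (∑[ i < ⌊ t /2⌋ ] ∑[ j < z t ] g (rad i j)
    + (spokeSum (halfInt? t) g + ∑[ j < N t ] g (bnd j)))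
∑ᴸ-allEdges t g with halfInt? t
... | yes p = ∑ᴸ-ringEdges-++ g (map (spoke p) (allFin (z t)) ++ map bnd (allFin (N t)))
                (trans (∑ᴸ-++ g (map (spoke p) (allFin (z t))) _)
                       (cong₂ _+_ (∑ᴸ-map-allFin (z t) g (spoke p)) (∑ᴸ-map-allFin (N t) g bnd)))
... | no _  = ∑ᴸ-ringEdges-++ g (map bnd (allFin (N t))) (∑ᴸ-map-allFin (N t) g bnd)

module RingDegree {t} (i : Fin (m t)) (j : Fin (z t)) where

  incidences : Edge t → ℕ
  incidences e = δᵛ (ring i j) (proj₁ (ends e)) + δᵛ (ring i j) (proj₂ (ends e))

  here : Fin (m t) → Fin (z t) → ℕ
  here i' j' = δᵛ (ring i j) (ring i' j')

  outward inward : ℕ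
  outward = ∑[ i' < ⌊ t /2⌋ ] δ i (inject₁ i')
  inward  = ∑[ i' < ⌊ t /2⌋ ] δ i (Fin.suc i')

  orbital : ∑[ i' < m t ] ∑[ j' < z t ] incidences (orb i' j') ≡ 2
  orbital = begin
    ∑[ i' < m t ] ∑[ j' < z t ] (here i' j' + here i' (rotate j'))
      ≡⟨ sum-cong-≗ (λ i' → ∑-distrib-+ (here i') (here i' ∘ rotate)) ⟩
    ∑[ i' < m t ] (∑[ j' < z t ] here i' j' + ∑[ j' < z t ] here i' (rotate j'))
      ≡⟨ sum-cong-≗ (λ i' → cong (_+_ (∑[ j' < z t ] here i' j')) (∑-rotate (here i'))) ⟩
    ∑[ i' < m t ] (∑[ j' < z t ] here i' j' + ∑[ j' < z t ] here i' j')
      ≡⟨ sum-cong-≗ (λ i' → cong₂ _+_ (∑-δᵛ-ring i j i') (∑-δᵛ-ring i j i')) ⟩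
    ∑[ i' < m t ] (δ i i' + δ i i')
      ≡⟨ ∑-distrib-+ (δ i) (δ i) ⟩
    ∑[ i' < m t ] δ i i' + ∑[ i' < m t ] δ i i'
      ≡⟨ cong₂ _+_ (∑-δ i) (∑-δ i) ⟩
    2 ∎
    where open ≡-Reasoning

  radial : ∑[ i' < ⌊ t /2⌋ ] ∑[ j' < z t ] incidences (rad i' j') ≡ outward + inward
  radial = begin
    ∑[ i' < ⌊ t /2⌋ ] ∑[ j' < z t ] (here (inject₁ i') j' + here (Fin.suc i') j')
      ≡⟨ sum-cong-≗ (λ i' → ∑-distrib-+ (here (inject₁ i')) (here (Fin.suc i'))) ⟩
    ∑[ i' < ⌊ t /2⌋ ] (∑[ j' < z t ] here (inject₁ i') j' + ∑[ j' < z t ] here (Fin.suc i') j')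
      ≡⟨ sum-cong-≗ (λ i' → cong₂ _+_ (∑-δᵛ-ring i j (inject₁ i')) (∑-δᵛ-ring i j (Fin.suc i'))) ⟩
    ∑[ i' < ⌊ t /2⌋ ] (δ i (inject₁ i') + δ i (Fin.suc i'))
      ≡⟨ ∑-distrib-+ (δ i ∘ inject₁) (δ i ∘ Fin.suc) ⟩
    outward + inward ∎
    where open ≡-Reasoning

  spokes : ∀ p → ∑[ j' < z t ] incidences (spoke p j') ≡ δ i Fin.zero
  spokes p = ∑-δᵛ-ring i j Fin.zero

  boundary : ∑[ j' < N t ] incidences (bnd j') ≡ δ i (top t)
  boundary = begin
    ∑[ j' < N t ] (here (top t) (j' ↑ˡ N t) + here (top t) (N t ↑ʳ j'))
      ≡⟨ ∑-distrib-+ (λ j' → here (top t) (j' ↑ˡ N t)) (λ j' → here (top t) (N t ↑ʳ j')) ⟩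
    ∑[ j' < N t ] here (top t) (j' ↑ˡ N t) + ∑[ j' < N t ] here (top t) (N t ↑ʳ j')
      ≡⟨ ∑-↑-split (N t) (N t) (here (top t)) ⟨
    ∑[ j' < z t ] here (top t) j'
      ≡⟨ ∑-δᵛ-ring i j (top t) ⟩
    δ i (top t) ∎
    where open ≡-Reasoning

  deg≡ : deg (ring i j) ≡ 2 + ((outward + inward) + (spokeSum (halfInt? t) incidences + δ i (top t)))
  deg≡ = trans (deg≡∑-incidences (ring i j)) (trans (∑ᴸ-allEdges t incidences)
           (cong₂ _+_ orbital (cong₂ _+_ radial (cong (_+_ (spokeSum (halfInt? t) incidences)) boundary))))

  outward+atTop≡1 : outward + δ i (top t) ≡ 1
  outward+atTop≡1 = trans (sym (sum-init-last (δ i))) (∑-δ i)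

  atCentre+inward≡1 : δ i Fin.zero + inward ≡ 1
  atCentre+inward≡1 = ∑-δ i

  ring-degree : Is3or4 (deg (ring i j))
  ring-degree = subst Is3or4 (sym deg≡) (by-halfInt (halfInt? t))
    where
    regroup : ∀ c → (outward + inward) + (c + δ i (top t)) ≡ 1 + (c + inward)
    regroup c = trans ([a+b]+[c+d]≡[a+d]+[c+b] outward inward c (δ i (top t)))
                      (cong (_+ (c + inward)) outward+atTop≡1)
    by-halfInt : (d : Dec (HalfInt t)) → Is3or4 (2 + ((outward + inward) + (spokeSum d incidences + δ i (top t))))
    by-halfInt (yes p) = inj₂ (cong (_+_ 2) (begin
      (outward + inward) + (spokeSum (yes p) incidences + δ i (top t))
        ≡⟨ cong (λ c → (outward + inward) + (c + δ i (top t))) (spokes p) ⟩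
      (outward + inward) + (δ i Fin.zero + δ i (top t))
        ≡⟨ regroup (δ i Fin.zero) ⟩
      1 + (δ i Fin.zero + inward)
        ≡⟨ cong (_+_ 1) atCentre+inward≡1 ⟩
      2 ∎))
      where open ≡-Reasoning
    by-halfInt (no _) =
      subst Is3or4 (cong (_+_ 2) (sym (regroup 0))) (3or4 (δ i Fin.zero) inward atCentre+inward≡1)
      where
      3or4 : ∀ a b → a + b ≡ 1 → Is3or4 (3 + b)
      3or4 0 1 _ = inj₂ refl
      3or4 1 0 _ = inj₁ refl

-- Parity at the centre and at the disk

handshake : ∀ {t} (vs : List (Vtx t)) → (∀ a → ∑ᴸ (λ v → δᵛ v a) vs ≡ 1) →
            ∀ F → ∑ᴸ (λ v → count F (star v)) vs ≡ 2 * count F (allEdges t)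
handshake {t} vs enumerates F = begin
  ∑ᴸ (λ v → count F (star v)) vs
    ≡⟨ ∑ᴸ-cong (λ v → trans (count-filter F (incident v) E) (count-∑ᴸ (λ e → incident v e ∧ F e) E))
               vs ⟩
  ∑ᴸ (λ v → ∑ᴸ (λ e → 𝟙 (incident v e ∧ F e)) E) vs
    ≡⟨ ∑ᴸ-comm (λ v e → 𝟙 (incident v e ∧ F e)) vs E ⟩
  ∑ᴸ (λ e → ∑ᴸ (λ v → 𝟙 (incident v e ∧ F e)) vs) E
    ≡⟨ ∑ᴸ-cong each-edge-twice E ⟩
  ∑ᴸ (λ e → 2 * 𝟙 (F e)) E
    ≡⟨ *-distribˡ-∑ᴸ 2 (𝟙 ∘ F) E ⟨
  2 * ∑ᴸ (𝟙 ∘ F) E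
    ≡⟨ cong (2 *_) (count-∑ᴸ F E) ⟨
  2 * count F E ∎
  where
  open ≡-Reasoning
  E : List (Edge t)
  E = allEdges t
  each-edge-twice : ∀ e → ∑ᴸ (λ v → 𝟙 (incident v e ∧ F e)) vs ≡ 2 * 𝟙 (F e)
  each-edge-twice e = begin
    ∑ᴸ (λ v → 𝟙 (incident v e ∧ F e)) vs
      ≡⟨ ∑ᴸ-cong (λ v → trans (𝟙-∧ (incident v e) (F e)) (cong (_* 𝟙 (F e)) (𝟙-incident v e)))
                 vs ⟩
    ∑ᴸ (λ v → (δᵛ v (proj₁ (ends e)) + δᵛ v (proj₂ (ends e))) * 𝟙 (F e)) vs
      ≡⟨ *-distribʳ-∑ᴸ (𝟙 (F e)) _ vs ⟨
    ∑ᴸ (λ v → δᵛ v (proj₁ (ends e)) + δᵛ v (proj₂ (ends e))) vs * 𝟙 (F e)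
      ≡⟨ cong (_* 𝟙 (F e)) (trans (∑ᴸ-distrib-+ _ _ vs) (cong₂ _+_ (enumerates _) (enumerates _))) ⟩
    2 * 𝟙 (F e) ∎

ringAt : ∀ {t} → Fin (m t) × Fin (z t) → Vtx t
ringAt (i , j) = ring i j

vertices : ∀ {t} → HalfInt t → List (Vtx t)
vertices p = map ringAt pairs ++ centre p ∷ []

vertices-enumerate : ∀ {t} (p : HalfInt t) a → ∑ᴸ (λ v → δᵛ v a) (vertices p) ≡ 1
vertices-enumerate {t} p a = begin
  ∑ᴸ (λ v → δᵛ v a) (map ringAt pairs ++ centre p ∷ [])
    ≡⟨ ∑ᴸ-++ (λ v → δᵛ v a) (map ringAt (pairs {m t} {z t})) (centre p ∷ []) ⟩
  ∑ᴸ (λ v → δᵛ v a) (map ringAt pairs) + (δᵛ (centre p) a + 0)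
    ≡⟨ cong₂ _+_ (∑ᴸ-map-pairs (m t) (z t) (λ v → δᵛ v a) ringAt) (ℕP.+-identityʳ (δᵛ (centre p) a)) ⟩
  ∑[ i < m t ] ∑[ j < z t ] δᵛ (ring i j) a + δᵛ (centre p) a
    ≡⟨ count-at a ⟩
  1 ∎
  where
  open ≡-Reasoning
  count-at : ∀ a → ∑[ i < m t ] ∑[ j < z t ] δᵛ (ring i j) a + δᵛ (centre p) a ≡ 1
  count-at (ring i j) = begin
    ∑[ i' < m t ] ∑[ j' < z t ] δᵛ (ring i' j') (ring i j) + 0
      ≡⟨ ℕP.+-identityʳ _ ⟩
    ∑[ i' < m t ] ∑[ j' < z t ] δᵛ (ring i' j') (ring i j)
      ≡⟨ sum-cong-≗ (λ i' → trans (sum-cong-≗ (λ j' → δᵛ-sym (ring i' j') (ring i j))) (∑-δᵛ-ring i j i')) ⟩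
    ∑[ i' < m t ] δ i i'
      ≡⟨ ∑-δ i ⟩
    1 ∎
  count-at (centre q) = cong₂ _+_ no-ring-is-centre (δᵛ-centre p q)
    where
    no-ring-is-centre : ∑[ i < m t ] ∑[ j < z t ] δᵛ (ring i j) (centre q) ≡ 0
    no-ring-is-centre = ∑-zero {n = m t} (λ i → ∑-zero {n = z t} (λ j → refl))

centre-parity : ∀ t (p : HalfInt t) (F : Edge t → Bool) →
                (∀ i j → odd (count F (star (ring i j))) ≡ odd (deg (ring i j))) →
                odd (count F (star (centre {t} p))) ≡ odd (deg (centre {t} p))
centre-parity t p F ring-parity = begin
  odd (count F (star (centre {t} p)))           ≡⟨ rings-match-centre F ⟨
  odd (∑ᴸ (ring-star F) ijs)                    ≡⟨ odd-∑ᴸ-cong (ring-star F) (ring-star all) ring-parity′ ijs ⟩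
  odd (∑ᴸ (ring-star all) ijs)                  ≡⟨ rings-match-centre all ⟩
  odd (count all (star (centre {t} p)))         ≡⟨ cong odd (count-true (star (centre {t} p))) ⟩
  odd (deg (centre {t} p))                      ∎
  where
  open ≡-Reasoning
  ijs : List (Fin (m t) × Fin (z t))
  ijs = pairs
  all : Edge t → Bool
  all _ = true
  ring-star : (Edge t → Bool) → Fin (m t) × Fin (z t) → ℕ
  ring-star G ij = count G (star (ringAt ij))
  ring-parity′ : ∀ ij → odd (ring-star F ij) ≡ odd (ring-star all ij)
  ring-parity′ (i , j) = trans (ring-parity i j) (cong odd (sym (count-true (star (ring i j)))))
  rings-match-centre : ∀ G → odd (∑ᴸ (ring-star G) ijs) ≡ odd (count G (star (centre {t} p)))
  rings-match-centre G = xor≡false⇒≡ _ _ (begin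
    odd (∑ᴸ (ring-star G) ijs) xor odd (count G (star (centre {t} p)))
      ≡⟨ cong (λ n → odd n xor odd (count G (star (centre {t} p))))
              (∑ᴸ-map (λ v → count G (star v)) ringAt ijs) ⟨
    odd (∑ᴸ (λ v → count G (star v)) (map ringAt ijs)) xor odd (count G (star (centre {t} p)))
      ≡⟨ odd-∑ᴸ-snoc (λ v → count G (star v)) (map ringAt ijs) (centre {t} p) ⟨
    odd (∑ᴸ (λ v → count G (star v)) (vertices p))
      ≡⟨ cong odd (handshake (vertices p) (vertices-enumerate p) G) ⟩
    odd (2 * count G (allEdges t))
      ≡⟨ odd-2* (count G (allEdges t)) ⟩
    false ∎)

band-parity : ∀ {t} k (F : Edge t → Bool) (u w v : Fin (suc k) → Edge t) →
              (∀ j → odd (count F (u j ∷ w (rotate j) ∷ v j ∷ w j ∷ [])) ≡ false) →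
              odd (∑[ j < suc k ] 𝟙 (F (u j))) ≡ odd (∑[ j < suc k ] 𝟙 (F (v j)))
band-parity {t} k F u w v even-faces = cancel (odd U) (odd W) (odd V) (begin
  odd U xor (odd W xor (odd V xor odd W))  ≡⟨ cong (odd U xor_) (cong (odd W xor_) (odd-+ V W)) ⟨
  odd U xor (odd W xor odd (V + W))        ≡⟨ cong (odd U xor_) (odd-+ W (V + W)) ⟨
  odd U xor odd (W + (V + W))              ≡⟨ odd-+ U (W + (V + W)) ⟨
  odd (U + (W + (V + W)))                  ≡⟨ cong odd total ⟨
  odd (∑[ j < suc k ] face-count j)       ≡⟨ odd-∑-even face-count even-faces ⟩
  false                                    ∎)
  where
  open ≡-Reasoning
  U V W : ℕ
  U = ∑[ j < suc k ] 𝟙 (F (u j))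
  V = ∑[ j < suc k ] 𝟙 (F (v j))
  W = ∑[ j < suc k ] 𝟙 (F (w j))
  f : (Fin (suc k) → Edge t) → Fin (suc k) → ℕ
  f e j = 𝟙 (F (e j))
  face-count : Fin (suc k) → ℕ
  face-count j = count F (u j ∷ w (rotate j) ∷ v j ∷ w j ∷ [])
  total : ∑[ j < suc k ] face-count j ≡ U + (W + (V + W))
  total = begin
    ∑[ j < suc k ] face-count j
      ≡⟨ sum-cong-≗ (λ j → count-∑ᴸ F (u j ∷ w (rotate j) ∷ v j ∷ w j ∷ [])) ⟩
    ∑[ j < suc k ] (f u j + (f w (rotate j) + (f v j + (f w j + 0))))
      ≡⟨ ∑-distrib-+ (f u) (λ j → f w (rotate j) + (f v j + (f w j + 0))) ⟩
    U + ∑[ j < suc k ] (f w (rotate j) + (f v j + (f w j + 0)))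
      ≡⟨ cong (_+_ U) (∑-distrib-+ (f w ∘ rotate) (λ j → f v j + (f w j + 0))) ⟩
    U + (∑[ j < suc k ] f w (rotate j) + ∑[ j < suc k ] (f v j + (f w j + 0)))
      ≡⟨ cong (_+_ U) (cong₂ _+_ (∑-rotate (f w)) (∑-distrib-+ (f v) (λ j → f w j + 0))) ⟩
    U + (W + (V + ∑[ j < suc k ] (f w j + 0)))
      ≡⟨ cong (λ r → U + (W + (V + r))) (sum-cong-≗ (λ j → ℕP.+-identityʳ (f w j))) ⟩
    U + (W + (V + W)) ∎
  cancel : ∀ a b c → a xor (b xor (c xor b)) ≡ false → a ≡ c
  cancel false _     false _  = refl
  cancel true  _     true  _  = refl
  cancel false false true  ()
  cancel false true  true  ()
  cancel true  false false ()
  cancel true  true  false ()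

disk-parity : ∀ t (F : Edge t → Bool) (q : N t % 2 ≡ 0) →
              (∀ i j → odd (count F (faceEdges (quad i j))) ≡ false) →
              (∀ j → odd (count F (faceEdges (outer j))) ≡ false) →
              odd (count F (faceEdges (disk {t} q))) ≡ false
disk-parity t F q even-quads even-outers = begin
  odd (count F (faceEdges (disk {t} q)))
    ≡⟨ cong odd (trans (count-∑ᴸ F _) (∑ᴸ-map-allFin (z t) (𝟙 ∘ F) (orb Fin.zero))) ⟩
  odd (layer Fin.zero)
    ≡⟨ telescope ⌊ t /2⌋ (odd ∘ layer)
         (λ i → band-parity _ F (orb (inject₁ i)) (rad i) (orb (Fin.suc i)) (even-quads i)) ⟩
  odd (layer (top t))
    ≡⟨ cong odd (∑-↑-split (N t) (N t) (λ j → 𝟙 (F (orb (top t) j)))) ⟩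
  odd (west + east)
    ≡⟨ odd-+ west east ⟩
  odd west xor odd east
    ≡⟨ cong (_xor odd east)
         (band-parity _ F (λ j → orb (top t) (j ↑ˡ N t)) bnd (λ j → orb (top t) (N t ↑ʳ j))
                      even-outers) ⟩
  odd east xor odd east
    ≡⟨ xor-same (odd east) ⟩
  false ∎
  where
  open ≡-Reasoning
  layer : Fin (m t) → ℕ
  layer i = ∑[ j < z t ] 𝟙 (F (orb i j))
  west east : ℕ
  west = ∑[ j < N t ] 𝟙 (F (orb (top t) (j ↑ˡ N t)))
  east = ∑[ j < N t ] 𝟙 (F (orb (top t) (N t ↑ʳ j)))

-- Strong O-joins and integer points of P₂'

disk-length-even : ∀ t (q : N t % 2 ≡ 0) → odd (faceLength (disk {t} q)) ≡ false
disk-length-even t q = trans (cong odd (trans (LP.length-map (orb Fin.zero) (allFin (z t)))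
                                              (LP.length-tabulate {n = z t} (λ j → j))))
                             (odd-double (N t))

V12-parity : ∀ t → (Edge t → Bool) → Set
V12-parity t F = ∀ p → V12 t p → odd (count F p) ≡ odd (length p)

strongOJoin⇒V12-parity : ∀ t F → StrongOJoin t F → V12-parity t F
strongOJoin⇒V12-parity t F (vertex-parity , face-parity) _ (inj₁ (v , refl , _)) =
  %2≡⇒odd≡ (count F (star v)) (deg v) (vertex-parity v)
strongOJoin⇒V12-parity t F (vertex-parity , face-parity) _ (inj₂ (f , refl , _)) =
  %2≡⇒odd≡ (count F (faceEdges f)) (faceLength f) (face-parity f)

V12-parity⇒strongOJoin : ∀ t F → V12-parity t F → StrongOJoin t F
V12-parity⇒strongOJoin t F parity =
    (λ v → odd≡⇒%2≡ (count F (star v)) (deg v) (vertex-odd v))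
  , (λ f → odd≡⇒%2≡ (count F (faceEdges f)) (faceLength f) (face-odd f))
  where
  ring-parity : ∀ i j → odd (count F (star (ring i j))) ≡ odd (deg (ring i j))
  ring-parity i j = parity _ (inj₁ (ring i j , refl , RingDegree.ring-degree i j))
  quad-parity : ∀ i j → odd (count F (faceEdges (quad i j))) ≡ false
  quad-parity i j = parity _ (inj₂ (quad i j , refl , inj₂ refl))
  outer-parity : ∀ j → odd (count F (faceEdges (outer j))) ≡ false
  outer-parity j = parity _ (inj₂ (outer j , refl , inj₂ refl))
  vertex-odd : ∀ v → odd (count F (star v)) ≡ odd (deg v)
  vertex-odd (ring i j) = ring-parity i j
  vertex-odd (centre p) = centre-parity t p F ring-parity
  face-odd : ∀ f → odd (count F (faceEdges f)) ≡ odd (faceLength f)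
  face-odd (tri p j)  = parity _ (inj₂ (tri p j , refl , inj₁ refl))
  face-odd (quad i j) = quad-parity i j
  face-odd (outer j)  = outer-parity j
  face-odd (disk q)   = trans (disk-parity t F q quad-parity outer-parity) (sym (disk-length-even t q))

Constraints : ∀ t → (Edge t → ℤ) → Set
Constraints t x = ∀ p → V12 t p → ∀ s → (length p ∸ count s p) % 2 ≡ 1 →
                  excess x s p ℤ.≤ + count s p ℤ.- + 1

constraints-cong : ∀ {t} {x y : Edge t → ℤ} → (∀ e → x e ≡ y e) → Constraints t x → Constraints t y
constraints-cong x≡y holds p p∈V12 s odd-complement =
  subst (ℤ._≤ + count s p ℤ.- + 1) (excess-cong x≡y s p) (holds p p∈V12 s odd-complement)

V12-parity⇒χ-constraints : ∀ t F → V12-parity t F → Constraints t (χ F)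
V12-parity⇒χ-constraints t F parity p p∈V12 = parity⇒constraint F p (parity p p∈V12)

χ-constraints⇒V12-parity : ∀ t F → Constraints t (χ F) → V12-parity t F
χ-constraints⇒V12-parity t F holds p p∈V12 = constraint⇒parity F p (holds p p∈V12 F)

mainTheorem5 : (t : ℕ) (x : Edge t → ℤ) →
    InP2' t x ⇔ Σ (Edge t → Bool) (λ F → StrongOJoin t F × (∀ e → x e ≡ χ F e))
mainTheorem5 t x = mk⇔ integral-point⇒strongOJoin strongOJoin⇒integral-point
  where
  integral-point⇒strongOJoin : InP2' t x →
                               Σ (Edge t → Bool) (λ F → StrongOJoin t F × (∀ e → x e ≡ χ F e))
  integral-point⇒strongOJoin (bounds , holds) = F , V12-parity⇒strongOJoin t F parity , x≡χF
    where
    F : Edge t → Bool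
    F e = isYes (x e ℤ.≟ + 1)
    x≡χF : ∀ e → x e ≡ χ F e
    x≡χF = χ-of-01 x bounds
    parity : V12-parity t F
    parity = χ-constraints⇒V12-parity t F (constraints-cong x≡χF holds)
  strongOJoin⇒integral-point : Σ (Edge t → Bool) (λ F → StrongOJoin t F × (∀ e → x e ≡ χ F e)) →
                               InP2' t x
  strongOJoin⇒integral-point (F , strong , x≡χF) =
      (λ e → subst (λ y → (+ 0 ℤ.≤ y) × (y ℤ.≤ + 1)) (sym (x≡χF e)) (χ-bounds F e))
    , constraints-cong (sym ∘ x≡χF) (V12-parity⇒χ-constraints t F (strongOJoin⇒V12-parity t F strong))
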